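{- Let $R$ be a set of permutations. Then for all $n \ge 1$, $$S_n(E(R)) = E(S_{n-1}(R)).$$ Moreover, for all $k \ge 0$, $$|S_n(E^k(R))| = \frac{n!}{(n-k)!} |S_{n-k}(R)| \quad (n \ge k), \qquad |S_n(E^k(R))| = n! \quad (0 \le n < k).$$
   Context: $S_n$ is the set of permutations of $\{1,\dots,n\}$ in one-line notation; $\pi$ avoids $\sigma\in S_k$ if no subsequence of $\pi$ of length $k$ has the same relative order as $\sigma$; $S_n(R)$ is the set of $\pi\in S_n$ avoiding every element of $R$, and $S_0(R)$ contains only the empty permutation. For $\alpha \in S_{m-1}$ and $\beta\in S_m$, $\beta$ is an extension of $\alpha$ if $\alpha$ is obtained by deleting the entry $m$ from $\beta$. For a set $R$ of permutations, $E(R)$ is the set of all extensions of elements of $R$; $E^0(R)=R$ and $E^k(R)=E(E^{k-1}(R))$ for $k\ge1$. -}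

module Defs where

open import Data.Nat using (ℕ; zero; suc; _<_; _≤_; _≟_)
open import Data.List using (List; []; _∷_; length; lookup; applyUpTo; filter)
open import Data.List.Relation.Binary.Permutation.Propositional using (_↭_)
open import Data.List.Relation.Binary.Sublist.Propositional using (_⊆_)
open import Data.List.Relation.Unary.Unique.Propositional using (Unique)
open import Data.List.Membership.Propositional using (_∈_)
open import Data.Fin using (Fin; cast)
open import Data.Product using (Σ; ∃; _×_)
open import Relation.Nullary using (¬_)
open import Relation.Nullary.Decidable using (¬?)
open import Relation.Binary.PropositionalEquality using (_≡_)
open import Function.Bundles using (_⇔_)

-- Permutations in one-line notation are lists of naturals.
-- A "set of permutations" is a predicate on such lists.
PermSet : Set₁
PermSet = List ℕ → Set

oneTo : ℕ → List ℕ
oneTo n = applyUpTo suc n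

IsPerm : ℕ → List ℕ → Set
IsPerm n π = π ↭ oneTo n

SameOrder : List ℕ → List ℕ → Set
SameOrder xs ys =
  Σ (length xs ≡ length ys) λ eq →
    (i j : Fin (length xs)) →
      (lookup xs i < lookup xs j) ⇔ (lookup ys (cast eq i) < lookup ys (cast eq j))

Contains : List ℕ → List ℕ → Set
Contains π σ = ∃ λ τ → (τ ⊆ π) × SameOrder τ σ

Avoids : List ℕ → List ℕ → Set
Avoids π σ = ¬ Contains π σ

S : ℕ → PermSet → PermSet
S n R π = IsPerm n π × ((σ : List ℕ) → R σ → Avoids π σ)

deleteEntry : ℕ → List ℕ → List ℕ
deleteEntry m = filter (λ x → ¬? (x ≟ m))

IsExtension : List ℕ → List ℕ → Set
IsExtension α β = 1 ≤ length β × IsPerm (length β) β × deleteEntry (length β) β ≡ α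

E : PermSet → PermSet
E R β = ∃ λ α → R α × IsExtension α β

E^ : ℕ → PermSet → PermSet
E^ zero R = R
E^ (suc k) R = E (E^ k R)

HasSize : PermSet → ℕ → Set
HasSize P m = Σ (List (List ℕ)) λ xs →
  Unique xs × length xs ≡ m × ((π : List ℕ) → (π ∈ xs) ⇔ P π)

IsPermSet : PermSet → Set
IsPermSet R = (σ : List ℕ) → R σ → IsPerm (length σ) σ

-- A permutation in S_{n+1} is a permutation α ∈ S_n with the entry n+1 inserted somewhere.
-- In an occurrence of an extension σ′ of σ, the entry matched to the maximum of σ′ is larger
-- than every other entry of the occurrence; deleting (or inserting) such matched maxima keeps
-- the relative order, so the insertion of n+1 into α contains an extension of σ exactly when α
-- contains σ. Thus S_{n+1}(E R) = E(S_n(R)), and since each α ∈ S_n has n+1 distinct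
-- insertions with α recoverable from each, |S_{n+1}(E R)| = (n+1) |S_n(R)|. Iterating k times
-- gives the factor n!/(n-k)!; for n < k the iteration ends at S_0(E^j R) = {ε}, giving n!.

module Submission where

open import Defs
open import Data.Nat using (ℕ; zero; suc; _+_; _≤_; _<_; _∸_; _*_; _/_; _!; z≤n; s≤s; _≟_)
open import Data.Nat.Properties using (_!≢0; ≤-refl; n≮n; <-asym; <-≤-trans; *-zeroʳ; *-suc; *-assoc; *-identityˡ; m∸n≤m; suc-injective; +-suc)
open import Data.Nat.DivMod using (n/n≡1; *-/-assoc)
open import Data.Nat.Divisibility using (m≤n⇒m!∣n!)
open import Data.List using (List; []; _∷_; _++_; [_]; length; zip; map)
import Data.List as List
open import Data.List.Properties using (applyUpTo-∷ʳ; length-applyUpTo; length-++; length-map; ∷-injectiveˡ; ∷-injectiveʳ; filter-all; filter-++; filter-reject)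
open import Data.List.Membership.Propositional using (_∈_; _∉_)
open import Data.List.Membership.Propositional.Properties
  using (∈-applyUpTo⁺; ∈-applyUpTo⁻; ∈-∃++; ∈-++⁺ˡ; ∈-++⁺ʳ; ∈-++⁻; ∈-insert; ∈-map⁺; ∈-map⁻)
open import Data.List.Relation.Unary.Any using (here; there)
open import Data.List.Relation.Unary.All as All using ([]; tabulate)
open import Data.List.Relation.Unary.AllPairs using ([]; _∷_)
open import Data.List.Relation.Unary.Unique.Propositional using (Unique)
import Data.List.Relation.Unary.Unique.Propositional.Properties as Unique
open import Data.List.Relation.Binary.Permutation.Propositional using (_↭_; ↭-refl; ↭-sym; ↭-trans; ↭-reflexive; prep)
open import Data.List.Relation.Binary.Permutation.Propositional.Properties
  using (∈-resp-↭; ↭-length; ↭-empty-inv; drop-mid; shift; ∷↭∷ʳ)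
open import Data.List.Relation.Binary.Sublist.Propositional using (_⊆_; []; _∷_; _∷ʳ_; ⊆-refl; ⊆-trans; lookup)
open import Data.List.Relation.Binary.Sublist.Propositional.Properties using (++⁺)
open import Data.Fin using (Fin; zero; suc; cast)
open import Data.Product using (∃; ∃₂; _×_; _,_; proj₁; proj₂)
open import Data.Empty using (⊥-elim)
open import Data.Sum using (inj₁; inj₂)
open import Relation.Nullary using (¬_; ¬?)
open import Relation.Binary.PropositionalEquality using (_≡_; _≢_; refl; sym; trans; cong; cong₂; subst; module ≡-Reasoning)
open import Function.Base using (_∘_)
open import Function.Construct.Composition using (_⇔-∘_)
open import Function.Construct.Symmetry using (⇔-sym)
open import Function.Bundles using (_⇔_; mk⇔; Equivalence)

length-++-∷ : ∀ {A : Set} (xs : List A) {y ys} → length (xs ++ y ∷ ys) ≡ suc (length (xs ++ ys))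
length-++-∷ xs {y} {ys} = begin
  length (xs ++ y ∷ ys)         ≡⟨ length-++ xs ⟩
  length xs + suc (length ys)   ≡⟨ +-suc (length xs) (length ys) ⟩
  suc (length xs + length ys)   ≡⟨ cong suc (length-++ xs) ⟨
  suc (length (xs ++ ys))       ∎
  where open ≡-Reasoning

length-++-∷-cancel : ∀ {A B : Set} (cs : List A) (as : List B) {t s ds bs} →
  length (cs ++ t ∷ ds) ≡ length (as ++ s ∷ bs) → length (cs ++ ds) ≡ length (as ++ bs)
length-++-∷-cancel cs as eq = suc-injective (trans (sym (length-++-∷ cs)) (trans eq (length-++-∷ as)))

splitAtLength : ∀ {A B : Set} (as bs : List A) (τ : List B) → length τ ≡ length (as ++ bs) →
  ∃₂ λ cs ds → τ ≡ cs ++ ds × length cs ≡ length as × length ds ≡ length bs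
splitAtLength []       bs τ       eq = [] , τ , refl , refl , eq
splitAtLength (a ∷ as) bs (x ∷ τ) eq with cs , ds , refl , e₁ , e₂ ← splitAtLength as bs τ (suc-injective eq) =
  x ∷ cs , ds , refl , cong suc e₁ , e₂

zip-++ : ∀ {A B : Set} (cs : List A) (as : List B) {ds bs} → length cs ≡ length as →
  zip (cs ++ ds) (as ++ bs) ≡ zip cs as ++ zip ds bs
zip-++ []       []       _  = refl
zip-++ (c ∷ cs) (a ∷ as) eq = cong ((c , a) ∷_) (zip-++ cs as (suc-injective eq))

zip-middle↭ : ∀ {A B : Set} (cs : List A) (as : List B) {t s ds bs} → length cs ≡ length as →
  zip (cs ++ t ∷ ds) (as ++ s ∷ bs) ↭ (t , s) ∷ zip (cs ++ ds) (as ++ bs)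
zip-middle↭ cs as {t} {s} e = ↭-trans (↭-reflexive (zip-++ cs as e))
  (↭-trans (shift (t , s) (zip cs as) _) (↭-reflexive (cong ((t , s) ∷_) (sym (zip-++ cs as e)))))

∈-zip⁻ˡ : ∀ {A B : Set} {a b} (xs : List A) (ys : List B) → (a , b) ∈ zip xs ys → a ∈ xs
∈-zip⁻ˡ (x ∷ xs) (y ∷ ys) (here refl) = here refl
∈-zip⁻ˡ (x ∷ xs) (y ∷ ys) (there m)   = there (∈-zip⁻ˡ xs ys m)

∈-zip⁻ʳ : ∀ {A B : Set} {a b} (xs : List A) (ys : List B) → (a , b) ∈ zip xs ys → b ∈ ys
∈-zip⁻ʳ (x ∷ xs) (y ∷ ys) (here refl) = here refl
∈-zip⁻ʳ (x ∷ xs) (y ∷ ys) (there m)   = there (∈-zip⁻ʳ xs ys m)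

∈-zip-partner : ∀ {A B : Set} {a} (xs : List A) (ys : List B) → length xs ≡ length ys → a ∈ xs → ∃ λ b → (a , b) ∈ zip xs ys
∈-zip-partner (x ∷ xs) (y ∷ ys) eq (here refl) = y , here refl
∈-zip-partner (x ∷ xs) (y ∷ ys) eq (there m) with b , m′ ← ∈-zip-partner xs ys (suc-injective eq) m = b , there m′

⊆-++⁻ : ∀ {A : Set} (ls : List A) {rs τ} → τ ⊆ ls ++ rs → ∃₂ λ cs ds → τ ≡ cs ++ ds × cs ⊆ ls × ds ⊆ rs
⊆-++⁻ []       {τ = τ} τ⊆ = [] , τ , refl , [] , τ⊆
⊆-++⁻ (l ∷ ls) (.l ∷ʳ τ⊆) with cs , ds , refl , cs⊆ , ds⊆ ← ⊆-++⁻ ls τ⊆ = cs , ds , refl , l ∷ʳ cs⊆ , ds⊆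
⊆-++⁻ (l ∷ ls) (refl ∷ τ⊆) with cs , ds , refl , cs⊆ , ds⊆ ← ⊆-++⁻ ls τ⊆ = l ∷ cs , ds , refl , refl ∷ cs⊆ , ds⊆

⊆-skip : ∀ {A : Set} (ls : List A) {x rs xs} → xs ⊆ ls ++ x ∷ rs → x ∉ xs → xs ⊆ ls ++ rs
⊆-skip []       (_ ∷ʳ xs⊆)    x∉ = xs⊆
⊆-skip []       (refl ∷ xs⊆)  x∉ = ⊥-elim (x∉ (here refl))
⊆-skip (l ∷ ls) (.l ∷ʳ xs⊆)   x∉ = l ∷ʳ ⊆-skip ls xs⊆ x∉
⊆-skip (l ∷ ls) (refl ∷ xs⊆)  x∉ = refl ∷ ⊆-skip ls xs⊆ (x∉ ∘ there)

oneTo-suc↭ : ∀ n → oneTo (suc n) ↭ suc n ∷ oneTo n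
oneTo-suc↭ n = subst (_↭ suc n ∷ oneTo n) (applyUpTo-∷ʳ suc n) (↭-sym (∷↭∷ʳ (suc n) (oneTo n)))

isPerm-length : ∀ {n π} → IsPerm n π → length π ≡ n
isPerm-length {n} p = trans (↭-length p) (length-applyUpTo suc n)

isPerm-bounded : ∀ {n π x} → IsPerm n π → x ∈ π → x ≤ n
isPerm-bounded p x∈π with _ , i<n , refl ← ∈-applyUpTo⁻ suc (∈-resp-↭ p x∈π) = i<n

isPerm-∌suc : ∀ {n π} → IsPerm n π → suc n ∉ π
isPerm-∌suc p m = n≮n _ (isPerm-bounded p m)

isPerm-suc⁺ : ∀ {n} ls rs → IsPerm n (ls ++ rs) → IsPerm (suc n) (ls ++ suc n ∷ rs)
isPerm-suc⁺ {n} ls rs p = ↭-trans (shift (suc n) ls rs) (↭-trans (prep (suc n) p) (↭-sym (oneTo-suc↭ n)))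

isPerm-suc⁻ : ∀ {n π} → IsPerm (suc n) π →
  ∃₂ λ ls rs → π ≡ ls ++ suc n ∷ rs × IsPerm n (ls ++ rs)
isPerm-suc⁻ {n} p
  with ls , rs , refl ← ∈-∃++ (∈-resp-↭ (↭-sym p) (∈-applyUpTo⁺ suc ≤-refl))
  = ls , rs , refl , drop-mid ls [] (↭-trans p (oneTo-suc↭ n))

deleteEntry-∉ : ∀ {x xs} → x ∉ xs → deleteEntry x xs ≡ xs
deleteEntry-∉ {x} x∉xs = filter-all (λ y → ¬? (y ≟ x)) (tabulate λ y∈xs y≡x → x∉xs (subst (_∈ _) y≡x y∈xs))

deleteEntry-middle : ∀ x ls rs → x ∉ ls ++ rs → deleteEntry x (ls ++ x ∷ rs) ≡ ls ++ rs
deleteEntry-middle x ls rs x∉ = begin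
  deleteEntry x (ls ++ x ∷ rs)                ≡⟨ filter-++ (λ y → ¬? (y ≟ x)) ls (x ∷ rs) ⟩
  deleteEntry x ls ++ deleteEntry x (x ∷ rs)  ≡⟨ cong (deleteEntry x ls ++_) (filter-reject (λ y → ¬? (y ≟ x)) (λ x≢x → x≢x refl)) ⟩
  deleteEntry x ls ++ deleteEntry x rs        ≡⟨ cong₂ _++_ (deleteEntry-∉ (x∉ ∘ ∈-++⁺ˡ)) (deleteEntry-∉ (x∉ ∘ ∈-++⁺ʳ ls)) ⟩
  ls ++ rs                                    ∎
  where open ≡-Reasoning

isExtension-insertTop : ∀ {L} ls rs → IsPerm L (ls ++ rs) → IsExtension (ls ++ rs) (ls ++ suc L ∷ rs)
isExtension-insertTop {L} ls rs p rewrite length-++-∷ ls {suc L} {rs} | isPerm-length p =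
  s≤s z≤n , isPerm-suc⁺ ls rs p , deleteEntry-middle (suc L) ls rs (isPerm-∌suc p)

record TopInsertion (α β : List ℕ) : Set where
  field
    size        : ℕ
    left right  : List ℕ
    α≡          : α ≡ left ++ right
    β≡          : β ≡ left ++ suc size ∷ right
    isPerm      : IsPerm size (left ++ right)

isExtension⇒topInsertion : ∀ {α β} → IsExtension α β → TopInsertion α β
isExtension⇒topInsertion {α} {β} (1≤ , p , del) = go (length β) 1≤ p del
  where
  go : ∀ L → 1 ≤ L → IsPerm L β → deleteEntry L β ≡ α → TopInsertion α β
  go (suc L) _ p del with ls , rs , refl , q ← isPerm-suc⁻ p =
    record { size = L ; left = ls ; right = rs
           ; α≡ = trans (sym del) (deleteEntry-middle (suc L) ls rs (isPerm-∌suc q))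
           ; β≡ = refl ; isPerm = q }

isExtension⁻ : ∀ {n α β} → IsPerm n α → IsExtension α β → ∃₂ λ ls rs → α ≡ ls ++ rs × β ≡ ls ++ suc n ∷ rs
isExtension⁻ p ext
  with record { left = ls ; right = rs ; α≡ = refl ; β≡ = refl ; isPerm = q } ← isExtension⇒topInsertion ext
  with refl ← trans (sym (isPerm-length p)) (isPerm-length q)
  = ls , rs , refl , refl

-- SameOrder recast on the matched pairs zip xs ys, so that deleting or inserting a matched
-- pair becomes an argument about list membership.
OrderIsomorphic : List (ℕ × ℕ) → Set
OrderIsomorphic ps = ∀ {a b c d} → (a , b) ∈ ps → (c , d) ∈ ps → (a < c) ⇔ (b < d)

orderIsomorphic-⊆ : ∀ {ps qs} → (∀ {p} → p ∈ ps → p ∈ qs) → OrderIsomorphic qs → OrderIsomorphic ps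
orderIsomorphic-⊆ ps⊆qs iso ab∈ cd∈ = iso (ps⊆qs ab∈) (ps⊆qs cd∈)

orderIsomorphic-∷-max : ∀ {t s ps} → (∀ {a b} → (a , b) ∈ ps → a < t × b < s) →
  OrderIsomorphic ps → OrderIsomorphic ((t , s) ∷ ps)
orderIsomorphic-∷-max below iso (here refl) (here refl) = mk⇔ (⊥-elim ∘ n≮n _) (⊥-elim ∘ n≮n _)
orderIsomorphic-∷-max below iso (here refl) (there cd∈) =
  mk⇔ (λ t<c → ⊥-elim (<-asym t<c (proj₁ (below cd∈)))) (λ s<d → ⊥-elim (<-asym s<d (proj₂ (below cd∈))))
orderIsomorphic-∷-max below iso (there ab∈) (here refl) = mk⇔ (λ _ → proj₂ (below ab∈)) (λ _ → proj₁ (below ab∈))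
orderIsomorphic-∷-max below iso (there ab∈) (there cd∈) = iso ab∈ cd∈

lookup∈zip : ∀ (xs ys : List ℕ) (eq : length xs ≡ length ys) (i : Fin (length xs)) →
  (List.lookup xs i , List.lookup ys (cast eq i)) ∈ zip xs ys
lookup∈zip (x ∷ xs) (y ∷ ys) eq zero    = here refl
lookup∈zip (x ∷ xs) (y ∷ ys) eq (suc i) = there (lookup∈zip xs ys (suc-injective eq) i)

∈zip⇒lookup : ∀ {a b : ℕ} (xs ys : List ℕ) (eq : length xs ≡ length ys) → (a , b) ∈ zip xs ys →
  ∃ λ i → List.lookup xs i ≡ a × List.lookup ys (cast eq i) ≡ b
∈zip⇒lookup (x ∷ xs) (y ∷ ys) eq (here refl) = zero , refl , refl
∈zip⇒lookup (x ∷ xs) (y ∷ ys) eq (there m) with i , refl , refl ← ∈zip⇒lookup xs ys (suc-injective eq) m = suc i , refl , refl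

sameOrder⇔orderIsomorphic : ∀ {xs ys} → SameOrder xs ys ⇔ (length xs ≡ length ys × OrderIsomorphic (zip xs ys))
sameOrder⇔orderIsomorphic {xs} {ys} = mk⇔ to from
  where
  to : SameOrder xs ys → length xs ≡ length ys × OrderIsomorphic (zip xs ys)
  to (eq , iso) = eq , λ ab∈ cd∈ → byIndex (∈zip⇒lookup xs ys eq ab∈) (∈zip⇒lookup xs ys eq cd∈)
    where
    byIndex : ∀ {a b c d} → (∃ λ i → List.lookup xs i ≡ a × List.lookup ys (cast eq i) ≡ b) →
      (∃ λ j → List.lookup xs j ≡ c × List.lookup ys (cast eq j) ≡ d) → (a < c) ⇔ (b < d)
    byIndex (i , refl , refl) (j , refl , refl) = iso i j
  from : length xs ≡ length ys × OrderIsomorphic (zip xs ys) → SameOrder xs ys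
  from (eq , iso) = eq , λ i j → iso (lookup∈zip xs ys eq i) (lookup∈zip xs ys eq j)

sameOrder-deleteMiddle : ∀ cs as {t s ds bs} → length cs ≡ length as →
  SameOrder (cs ++ t ∷ ds) (as ++ s ∷ bs) → SameOrder (cs ++ ds) (as ++ bs)
sameOrder-deleteMiddle cs as e so with eq , iso ← Equivalence.to sameOrder⇔orderIsomorphic so =
  Equivalence.from sameOrder⇔orderIsomorphic
    (length-++-∷-cancel cs as eq , orderIsomorphic-⊆ (∈-resp-↭ (↭-sym (zip-middle↭ cs as e)) ∘ there) iso)

sameOrder-insertMax : ∀ cs as {t s ds bs} → length cs ≡ length as →
  (∀ {a} → a ∈ cs ++ ds → a < t) → (∀ {b} → b ∈ as ++ bs → b < s) →
  SameOrder (cs ++ ds) (as ++ bs) → SameOrder (cs ++ t ∷ ds) (as ++ s ∷ bs)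
sameOrder-insertMax cs as e <t <s so with eq , iso ← Equivalence.to sameOrder⇔orderIsomorphic so =
  Equivalence.from sameOrder⇔orderIsomorphic
    ( trans (length-++-∷ cs) (trans (cong suc eq) (sym (length-++-∷ as)))
    , orderIsomorphic-⊆ (∈-resp-↭ (zip-middle↭ cs as e))
        (orderIsomorphic-∷-max (λ m → <t (∈-zip⁻ˡ _ _ m) , <s (∈-zip⁻ʳ _ _ m)) iso))

sameOrder-splitAtMax : ∀ as {s bs} τ → (∀ {b} → b ∈ as ++ bs → b < s) → SameOrder τ (as ++ s ∷ bs) →
  ∃₂ λ cs ds → ∃ λ t → τ ≡ cs ++ t ∷ ds × length cs ≡ length as × (∀ {a} → a ∈ cs ++ ds → a < t)
sameOrder-splitAtMax as {s} {bs} τ <s so with eq , iso ← Equivalence.to (sameOrder⇔orderIsomorphic {τ}) so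
  with splitAtLength as (s ∷ bs) τ eq
... | cs , []     , _    , _ , ()
... | cs , t ∷ ds , refl , e , _ = cs , ds , t , refl , e , <t
  where
  inFull : ∀ {p} → p ∈ (t , s) ∷ zip (cs ++ ds) (as ++ bs) → p ∈ zip (cs ++ t ∷ ds) (as ++ s ∷ bs)
  inFull = ∈-resp-↭ (↭-sym (zip-middle↭ cs as e))
  <t : ∀ {a} → a ∈ cs ++ ds → a < t
  <t a∈ with b , ab∈ ← ∈-zip-partner (cs ++ ds) (as ++ bs) (length-++-∷-cancel cs as eq) a∈ =
    Equivalence.from (iso (inFull (there ab∈)) (inFull (here refl))) (<s (∈-zip⁻ʳ _ _ ab∈))

contains-insertTop : ∀ {n L} ls rs {σ} → IsPerm n (ls ++ rs) → IsPerm L σ → Contains (ls ++ rs) σ →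
  ∃ λ σ′ → IsExtension σ σ′ × Contains (ls ++ suc n ∷ rs) σ′
contains-insertTop {n} {L} ls rs {σ} p pσ (τ , τ⊆ , so)
  with cs , ds , refl , cs⊆ , ds⊆ ← ⊆-++⁻ ls τ⊆
  with as , bs , refl , e , _ ← splitAtLength cs ds σ (sym (proj₁ so))
  = as ++ suc L ∷ bs , isExtension-insertTop as bs pσ ,
    cs ++ suc n ∷ ds , ++⁺ cs⊆ (refl ∷ ds⊆) ,
    sameOrder-insertMax cs as (sym e) (s≤s ∘ isPerm-bounded p ∘ lookup τ⊆) (s≤s ∘ isPerm-bounded pσ) so

contains-extension⇒contains : ∀ {n} ls rs {σ σ′} → IsPerm n (ls ++ rs) → IsExtension σ σ′ →
  Contains (ls ++ suc n ∷ rs) σ′ → Contains (ls ++ rs) σ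
contains-extension⇒contains {n} ls rs p ext (τ , τ⊆ , so)
  with record { left = as ; α≡ = refl ; β≡ = refl ; isPerm = pσ } ← isExtension⇒topInsertion ext
  with cs , ds , t , refl , e , <t ← sameOrder-splitAtMax as τ (s≤s ∘ isPerm-bounded pσ) so
  = cs ++ ds , ⊆-skip ls (⊆-trans (++⁺ ⊆-refl (t ∷ʳ ⊆-refl)) τ⊆) top∉ , sameOrder-deleteMiddle cs as e so
  where
  t≤top : t ≤ suc n
  t≤top = isPerm-bounded (isPerm-suc⁺ ls rs p) (lookup τ⊆ (∈-insert cs))
  top∉ : suc n ∉ cs ++ ds
  top∉ m = n≮n _ (<-≤-trans (<t m) t≤top)

S-suc-E⇔E-S : ∀ R → IsPermSet R → ∀ n π → S (suc n) (E R) π ⇔ E (S n R) π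
S-suc-E⇔E-S R isPermR n π = mk⇔ to from
  where
  to : S (suc n) (E R) π → E (S n R) π
  to (p , avoidsE) with ls , rs , refl , q ← isPerm-suc⁻ p = ls ++ rs , (q , avoidsR) , isExtension-insertTop ls rs q
    where
    avoidsR : ∀ σ → R σ → Avoids (ls ++ rs) σ
    avoidsR σ Rσ c with σ′ , ext , c′ ← contains-insertTop ls rs q (isPermR σ Rσ) c = avoidsE σ′ (σ , Rσ , ext) c′
  from : E (S n R) π → S (suc n) (E R) π
  from (α , (q , avoidsR) , ext) with ls , rs , refl , refl ← isExtension⁻ q ext = isPerm-suc⁺ ls rs q , avoidsE
    where
    avoidsE : ∀ σ′ → E R σ′ → Avoids (ls ++ suc n ∷ rs) σ′
    avoidsE σ′ (σ , Rσ , ext) c = avoidsR σ Rσ (contains-extension⇒contains ls rs q ext c)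

insertions : ℕ → List ℕ → List (List ℕ)
insertions x []       = [ [ x ] ]
insertions x (y ∷ ys) = (x ∷ y ∷ ys) ∷ map (y ∷_) (insertions x ys)

∈-insertions⁺ : ∀ x ls rs → ls ++ x ∷ rs ∈ insertions x (ls ++ rs)
∈-insertions⁺ x []       []       = here refl
∈-insertions⁺ x []       (r ∷ rs) = here refl
∈-insertions⁺ x (l ∷ ls) rs       = there (∈-map⁺ (l ∷_) (∈-insertions⁺ x ls rs))

∈-insertions⁻ : ∀ x α {β} → β ∈ insertions x α → ∃₂ λ ls rs → α ≡ ls ++ rs × β ≡ ls ++ x ∷ rs
∈-insertions⁻ x []       (here refl) = [] , [] , refl , refl
∈-insertions⁻ x (y ∷ ys) (here refl) = [] , y ∷ ys , refl , refl
∈-insertions⁻ x (y ∷ ys) (there m)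
  with _ , m′ , refl ← ∈-map⁻ (y ∷_) m
  with ls , rs , refl , refl ← ∈-insertions⁻ x ys m′
  = y ∷ ls , rs , refl , refl

length-insertions : ∀ x α → length (insertions x α) ≡ suc (length α)
length-insertions x []       = refl
length-insertions x (y ∷ ys) = cong suc (trans (length-map (y ∷_) (insertions x ys)) (length-insertions x ys))

deleteEntry-insertions : ∀ x α {β} → x ∉ α → β ∈ insertions x α → deleteEntry x β ≡ α
deleteEntry-insertions x α x∉ m with ls , rs , refl , refl ← ∈-insertions⁻ x α m = deleteEntry-middle x ls rs x∉

insertions-unique : ∀ x α → x ∉ α → Unique (insertions x α)
insertions-unique x []       x∉ = [] ∷ []
insertions-unique x (y ∷ ys) x∉ =
  tabulate headFresh ∷ Unique.map⁺ ∷-injectiveʳ (insertions-unique x ys (x∉ ∘ there))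
  where
  headFresh : ∀ {β} → β ∈ map (y ∷_) (insertions x ys) → x ∷ y ∷ ys ≢ β
  headFresh m eq with _ , _ , refl ← ∈-map⁻ (y ∷_) m = x∉ (here (∷-injectiveˡ eq))

allInsertions : ℕ → List (List ℕ) → List (List ℕ)
allInsertions x []       = []
allInsertions x (α ∷ αs) = insertions x α ++ allInsertions x αs

∈-allInsertions⁺ : ∀ x {α β} αs → α ∈ αs → β ∈ insertions x α → β ∈ allInsertions x αs
∈-allInsertions⁺ x (α ∷ αs) (here refl) m = ∈-++⁺ˡ m
∈-allInsertions⁺ x (α ∷ αs) (there α∈) m = ∈-++⁺ʳ (insertions x α) (∈-allInsertions⁺ x αs α∈ m)

∈-allInsertions⁻ : ∀ x αs {β} → β ∈ allInsertions x αs → ∃ λ α → α ∈ αs × β ∈ insertions x α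
∈-allInsertions⁻ x (α ∷ αs) m with ∈-++⁻ (insertions x α) m
... | inj₁ m′ = α , here refl , m′
... | inj₂ m′ with α′ , α′∈ , m″ ← ∈-allInsertions⁻ x αs m′ = α′ , there α′∈ , m″

length-allInsertions : ∀ x n αs → (∀ {α} → α ∈ αs → length α ≡ n) → length (allInsertions x αs) ≡ suc n * length αs
length-allInsertions x n []       _     = sym (*-zeroʳ n)
length-allInsertions x n (α ∷ αs) len = begin
  length (insertions x α ++ allInsertions x αs)             ≡⟨ length-++ (insertions x α) ⟩
  length (insertions x α) + length (allInsertions x αs)     ≡⟨ cong₂ _+_ (trans (length-insertions x α) (cong suc (len (here refl))))
                                                                           (length-allInsertions x n αs (len ∘ there)) ⟩
  suc n + suc n * length αs                                 ≡⟨ *-suc (suc n) (length αs) ⟨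
  suc n * suc (length αs)                                   ∎
  where open ≡-Reasoning

allInsertions-unique : ∀ x αs → (∀ {α} → α ∈ αs → x ∉ α) → Unique αs → Unique (allInsertions x αs)
allInsertions-unique x []       _   _           = []
allInsertions-unique x (α ∷ αs) x∉ (α∉ ∷ uniq) =
  Unique.++⁺ (insertions-unique x α (x∉ (here refl))) (allInsertions-unique x αs (x∉ ∘ there) uniq) disjoint
  where
  disjoint : ∀ {β} → ¬ (β ∈ insertions x α × β ∈ allInsertions x αs)
  disjoint (m , m′) with α′ , α′∈ , m″ ← ∈-allInsertions⁻ x αs m′ =
    All.lookup α∉ α′∈ (trans (sym (deleteEntry-insertions x α (x∉ (here refl)) m))
                             (deleteEntry-insertions x α′ (x∉ (there α′∈)) m″))

hasSize-resp-⇔ : ∀ {P Q : PermSet} {m} → (∀ π → P π ⇔ Q π) → HasSize P m → HasSize Q m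
hasSize-resp-⇔ P⇔Q (xs , uniq , len , ∈⇔P) = xs , uniq , len , λ π → P⇔Q π ⇔-∘ ∈⇔P π

hasSize-E : ∀ {P : PermSet} {n c} → (∀ α → P α → IsPerm n α) → HasSize P c → HasSize (E P) (suc n * c)
hasSize-E {P} {n} perm (αs , uniq , len , ∈⇔P) =
  allInsertions (suc n) αs ,
  allInsertions-unique (suc n) αs (isPerm-∌suc ∘ permOf) uniq ,
  trans (length-allInsertions (suc n) n αs (isPerm-length ∘ permOf)) (cong (suc n *_) len) ,
  λ β → mk⇔ to from
  where
  permOf : ∀ {α} → α ∈ αs → IsPerm n α
  permOf α∈ = perm _ (Equivalence.to (∈⇔P _) α∈)
  to : ∀ {β} → β ∈ allInsertions (suc n) αs → E P β
  to m with α , α∈ , m′ ← ∈-allInsertions⁻ (suc n) αs m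
       with ls , rs , refl , refl ← ∈-insertions⁻ (suc n) α m′
    = ls ++ rs , Equivalence.to (∈⇔P _) α∈ , isExtension-insertTop ls rs (permOf α∈)
  from : ∀ {β} → E P β → β ∈ allInsertions (suc n) αs
  from (α , Pα , ext) with ls , rs , refl , refl ← isExtension⁻ (perm α Pα) ext =
    ∈-allInsertions⁺ (suc n) αs (Equivalence.from (∈⇔P _) Pα) (∈-insertions⁺ (suc n) ls rs)

isPermSet-E^ : ∀ {R} k → IsPermSet R → IsPermSet (E^ k R)
isPermSet-E^ zero    isPermR = isPermR
isPermSet-E^ (suc k) _       β (_ , _ , _ , p , _) = p

hasSize-S-suc-E : ∀ {R n c} → IsPermSet R → HasSize (S n R) c → HasSize (S (suc n) (E R)) (suc n * c)
hasSize-S-suc-E {R} {n} isPermR h = hasSize-resp-⇔ (λ π → ⇔-sym (S-suc-E⇔E-S R isPermR n π)) (hasSize-E (λ _ → proj₁) h)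

[]-avoids-nonempty : ∀ {σ} → 1 ≤ length σ → Avoids [] σ
[]-avoids-nonempty 1≤ (.[] , [] , len , _) with () ← subst (1 ≤_) (sym len) 1≤

hasSize-S-zero-E : ∀ {R} → HasSize (S 0 (E R)) 1
hasSize-S-zero-E = [ [] ] , [] ∷ [] , refl , λ π → mk⇔ to from
  where
  to : ∀ {π} → π ∈ [ [] ] → S 0 (E _) π
  to (here refl) = ↭-refl , λ { σ′ (_ , _ , 1≤ , _) → []-avoids-nonempty {σ′} 1≤ }
  from : ∀ {π} → S 0 (E _) π → π ∈ [ [] ]
  from (p , _) with refl ← ↭-empty-inv p = here refl

hasSize-S-E^-small : ∀ {R} → IsPermSet R → ∀ k n → n < k → HasSize (S n (E^ k R)) (n !)
hasSize-S-E^-small isPermR (suc k) zero    _         = hasSize-S-zero-E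
hasSize-S-E^-small isPermR (suc k) (suc n) (s≤s n<k) =
  hasSize-S-suc-E (isPermSet-E^ k isPermR) (hasSize-S-E^-small isPermR k n n<k)

hasSize-S-E^ : ∀ {R} → IsPermSet R → ∀ k n → k ≤ n → ∀ m → HasSize (S (n ∸ k) R) m →
  HasSize (S n (E^ k R)) ((n ! / (n ∸ k) !) {{(n ∸ k) !≢0}} * m)
hasSize-S-E^ isPermR zero n _ m h = subst (HasSize _) (sym count) h
  where
  count : (n ! / n !) {{n !≢0}} * m ≡ m
  count = trans (cong (_* m) (n/n≡1 (n !) {{n !≢0}})) (*-identityˡ m)
hasSize-S-E^ isPermR (suc k) (suc n) (s≤s k≤n) m h =
  subst (HasSize _) count (hasSize-S-suc-E (isPermSet-E^ k isPermR) (hasSize-S-E^ isPermR k n k≤n m h))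
  where
  instance _ = (n ∸ k) !≢0
  count : suc n * (n ! / (n ∸ k) ! * m) ≡ suc n * n ! / (n ∸ k) ! * m
  count = begin
    suc n * (n ! / (n ∸ k) ! * m)  ≡⟨ *-assoc (suc n) (n ! / (n ∸ k) !) m ⟨
    suc n * (n ! / (n ∸ k) !) * m  ≡⟨ cong (_* m) (*-/-assoc (suc n) (m≤n⇒m!∣n! (m∸n≤m n k))) ⟨
    suc n * n ! / (n ∸ k) ! * m    ∎
    where open ≡-Reasoning

mainTheorem18 : (R : PermSet) → IsPermSet R →
    ((n : ℕ) → (π : List ℕ) → S (suc n) (E R) π ⇔ E (S n R) π)
    × ((k n : ℕ) → k ≤ n → (m : ℕ) → HasSize (S (n ∸ k) R) m →
        HasSize (S n (E^ k R)) ((n ! / (n ∸ k) !) {{(n ∸ k) !≢0}} * m))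
    × ((k n : ℕ) → n < k → HasSize (S n (E^ k R)) (n !))
mainTheorem18 R isPermR = S-suc-E⇔E-S R isPermR , hasSize-S-E^ isPermR , hasSize-S-E^-small isPermR
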